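{- Let $n\ge r\ge1$ be integers and $q$ a prime power. There exists a Kakeya set $K\subseteq\mathbb{F}_q^n$ of rank $r$ such that $$|K|<q^{n(1-q^{ -r})+r+1}.$$
   Context: $\mathbb{F}_q$ denotes the finite field with $q$ elements. For a finite vector space $V$ and an integer $0\le r\le\dim V$, a subset $K\subseteq V$ is a Kakeya set of rank $r$ if for every subspace $L\le V$ with $\dim L=r$ there exists $v\in V$ such that $v+L\subseteq K$. -}

module Defs where

open import Level using (0ℓ)
open import Data.Nat using (ℕ)
open import Data.Fin using (Fin)
open import Data.Vec using (Vec; []; _∷_; zipWith; map; replicate)
open import Data.List using (List)
open import Data.List.Membership.Propositional using (_∈_)
open import Data.Product using (∃)
open import Relation.Binary.PropositionalEquality using (_≡_)
open import Relation.Nullary using (¬_)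
open import Algebra.Core using (Op₁; Op₂)
open import Algebra.Structures using (IsCommutativeRing)

record FiniteField (q : ℕ) : Set where
  field
    _+_ _*_ : Op₂ (Fin q)
    -_      : Op₁ (Fin q)
    0# 1#   : Fin q
    isCommutativeRing : IsCommutativeRing _≡_ _+_ _*_ -_ 0# 1#
    0≢1     : ¬ (0# ≡ 1#)
    inverse : ∀ x → ¬ (x ≡ 0#) → ∃ λ y → x * y ≡ 1#

module _ {q : ℕ} (F : FiniteField q) where
  open FiniteField F

  Vecₙ : ℕ → Set
  Vecₙ n = Vec (Fin q) n

  _⊕_ : ∀ {n} → Vecₙ n → Vecₙ n → Vecₙ n
  _⊕_ = zipWith _+_

  zeroV : ∀ n → Vecₙ n
  zeroV n = replicate n 0#

  _·_ : ∀ {n} → Fin q → Vecₙ n → Vecₙ n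
  c · v = map (c *_) v

  lincomb : ∀ {n r} → Vec (Fin q) r → Vec (Vecₙ n) r → Vecₙ n
  lincomb {n} []       []       = zeroV n
  lincomb     (c ∷ cs) (v ∷ vs) = (c · v) ⊕ lincomb cs vs

  LinearlyIndependent : ∀ {n r} → Vec (Vecₙ n) r → Set
  LinearlyIndependent {n} {r} vs =
    ∀ (cs : Vec (Fin q) r) → lincomb cs vs ≡ zeroV n → cs ≡ replicate r 0#

  IsKakeya : ∀ n r → List (Vecₙ n) → Set
  IsKakeya n r K =
    ∀ (vs : Vec (Vecₙ n) r) → LinearlyIndependent vs →
      ∃ λ (v : Vecₙ n) → ∀ (cs : Vec (Fin q) r) → (v ⊕ lincomb cs vs) ∈ K

{-# OPTIONS --safe #-}
-- Let m = ⌊n / q^r⌋ and cut the coordinates into q^r disjoint blocks of m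
-- consecutive coordinates, one block for each coefficient vector c ∈ F_q^r.
-- Given v_1, …, v_r, take the translate v that equals −Σ c_i v_i on the block
-- of c; then v + Σ c_i v_i vanishes on the block of c.  Hence the union K of
-- the subspaces {x : x vanishes on a block} is a Kakeya set of rank r with
-- |K| ≤ q^r · q^(n−m), and (r + n − m) q^r < n (q^r − 1) + (r + 1) q^r because
-- n − m q^r = n mod q^r < q^r.
module Submission where

open import Defs
open import Data.Nat using (ℕ; _≤_; _<_; _+_; _*_; _∸_; _^_)
open import Data.List using (List; length)
open import Data.List.Relation.Unary.Unique.Propositional using (Unique)
open import Data.Product using (∃; _×_)

open import Function using (_∘_; id)
open import Data.Nat using (zero; suc; z≤n; s≤s; z<s; NonZero; >-nonZero)
open import Data.Nat.Properties
open import Data.Nat.DivMod using (_/_; _%_; m%n<n; m/n*n≤m; m%n≡m∸m/n*n)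
open import Data.Nat.Solver using (module +-*-Solver)
open import Data.Fin as Fin using (Fin; toℕ; finToFun; funToFin)
open import Data.Fin.Properties using (toℕ<n; toℕ-injective; finToFun-funToFin; any?)
open import Data.Fin.Subset using (Subset; inside; outside; ⊥; ∣_∣; ∁)
  renaming (_∈_ to _∈ₛ_)
open import Data.Fin.Subset.Properties using (_∈?_; ∉⊥; ∣⊥∣≡0; ∣∁p∣≡n∸∣p∣)
open import Data.Vec using (Vec; []; _∷_; here; there; lookup; tabulate)
open import Data.Vec.Properties using (lookup-zipWith; lookup∘tabulate; tabulate-cong; tabulate∘lookup; ≡-dec)
open import Data.List using ([]; _∷_; _++_; map; concatMap; cartesianProductWith; allFin; deduplicate)
open import Data.List.Properties using (length-++; length-map; length-tabulate; length-deduplicate)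
open import Data.List.Membership.Propositional using (_∈_; lose)
open import Data.List.Membership.Propositional.Properties
  using (∈-map⁺; ∈-cartesianProductWith⁺; ∈-concatMap⁺; ∈-allFin; ∈-deduplicate⁺)
open import Data.List.Relation.Unary.Any using (here)
open import Data.List.Relation.Unary.Unique.DecPropositional.Properties using (deduplicate-!)
open import Data.Product using (_,_; proj₂)
open import Algebra.Structures using (IsCommutativeRing)
open import Relation.Nullary using (Dec; yes; no; contradiction)
open import Relation.Binary.PropositionalEquality using (_≡_; refl; trans; cong; cong₂; subst; module ≡-Reasoning)

length-cartesianProductWith : ∀ {a b c} {A : Set a} {B : Set b} {C : Set c} (f : A → B → C) xs ys →
                              length (cartesianProductWith f xs ys) ≡ length xs * length ys
length-cartesianProductWith f []       ys = refl
length-cartesianProductWith f (x ∷ xs) ys = begin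
  length (map (f x) ys ++ cartesianProductWith f xs ys)          ≡⟨ length-++ (map (f x) ys) ⟩
  length (map (f x) ys) + length (cartesianProductWith f xs ys)  ≡⟨ cong₂ _+_ (length-map (f x) ys) (length-cartesianProductWith f xs ys) ⟩
  length ys + length xs * length ys                              ∎
  where open ≡-Reasoning

length-concatMap-≤ : ∀ {a b} {A : Set a} {B : Set b} (f : A → List B) {c} →
                     (∀ x → length (f x) ≤ c) → ∀ xs → length (concatMap f xs) ≤ length xs * c
length-concatMap-≤ f bound []       = z≤n
length-concatMap-≤ f bound (x ∷ xs) =
  ≤-trans (≤-reflexive (length-++ (f x))) (+-mono-≤ (bound x) (length-concatMap-≤ f bound xs))

-- {a, …, a + m − 1}, truncated to the coordinates of Fin n.
interval : ∀ {n} → ℕ → ℕ → Subset n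
interval {zero}  _       _       = []
interval {suc n} (suc a) m       = outside ∷ interval a m
interval {suc n} zero    zero    = ⊥
interval {suc n} zero    (suc m) = inside ∷ interval zero m

∣interval∣ : ∀ {n} a m → a + m ≤ n → ∣ interval {n} a m ∣ ≡ m
∣interval∣ {zero}  zero    zero    _           = refl
∣interval∣ {suc n} (suc a) m       (s≤s a+m≤n) = ∣interval∣ a m a+m≤n
∣interval∣ {suc n} zero    zero    _           = ∣⊥∣≡0 (suc n)
∣interval∣ {suc n} zero    (suc m) (s≤s m≤n)   = cong suc (∣interval∣ zero m m≤n)

∈-interval⁻ : ∀ {n} a m {i : Fin n} → i ∈ₛ interval a m → a ≤ toℕ i × toℕ i < a + m
∈-interval⁻ {suc n} (suc a) m       (there i∈) with ∈-interval⁻ a m i∈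
... | a≤i , i<a+m = s≤s a≤i , s≤s i<a+m
∈-interval⁻ {suc n} zero    zero    i∈         = contradiction i∈ ∉⊥
∈-interval⁻ {suc n} zero    (suc m) here       = z≤n , s≤s z≤n
∈-interval⁻ {suc n} zero    (suc m) (there i∈) = z≤n , s≤s (proj₂ (∈-interval⁻ zero m i∈))

a*m≤j<b*m+m⇒a≤b : ∀ {a b j} m → a * m ≤ j → j < b * m + m → a ≤ b
a*m≤j<b*m+m⇒a≤b {a} {b} {j} m a*m≤j j<b*m+m = ≮⇒≥ λ b<a → <-irrefl refl (begin-strict
  j          <⟨ j<b*m+m ⟩
  b * m + m  ≡⟨ +-comm (b * m) m ⟩
  suc b * m  ≤⟨ *-monoˡ-≤ m b<a ⟩
  a * m      ≤⟨ a*m≤j ⟩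
  j          ∎)
  where open ≤-Reasoning

[n∸n/Q]*Q≡n*[Q∸1]+n%Q : ∀ n Q .{{_ : NonZero Q}} → (n ∸ n / Q) * Q ≡ n * (Q ∸ 1) + n % Q
[n∸n/Q]*Q≡n*[Q∸1]+n%Q n Q@(suc P) = begin
  (n ∸ n / Q) * Q          ≡⟨ *-distribʳ-∸ Q n (n / Q) ⟩
  n * Q ∸ n / Q * Q        ≡⟨ cong (_∸ n / Q * Q) (trans (*-suc n P) (+-comm n (n * P))) ⟩
  n * P + n ∸ n / Q * Q    ≡⟨ +-∸-assoc (n * P) (m/n*n≤m n Q) ⟩
  n * P + (n ∸ n / Q * Q)  ≡⟨ cong (n * P +_) (m%n≡m∸m/n*n n Q) ⟨
  n * P + n % Q            ∎
  where open ≡-Reasoning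

exponent-bound : ∀ n r Q .{{_ : NonZero Q}} → (r + (n ∸ n / Q)) * Q < n * (Q ∸ 1) + (r + 1) * Q
exponent-bound n r Q = begin-strict
  (r + (n ∸ n / Q)) * Q          ≡⟨ *-distribʳ-+ Q r (n ∸ n / Q) ⟩
  r * Q + (n ∸ n / Q) * Q        ≡⟨ cong (r * Q +_) ([n∸n/Q]*Q≡n*[Q∸1]+n%Q n Q) ⟩
  r * Q + (n * (Q ∸ 1) + n % Q)  <⟨ +-monoʳ-< (r * Q) (+-monoʳ-< (n * (Q ∸ 1)) (m%n<n n Q)) ⟩
  r * Q + (n * (Q ∸ 1) + Q)      ≡⟨ solve 3 (λ r Q x → r :* Q :+ (x :+ Q) := x :+ (r :+ con 1) :* Q) refl r Q (n * (Q ∸ 1)) ⟩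
  n * (Q ∸ 1) + (r + 1) * Q      ∎
  where open ≤-Reasoning
        open +-*-Solver using (solve; _:+_; _:*_; con; _:=_)

coefficients : ∀ {q r} → Fin (q ^ r) → Vec (Fin q) r
coefficients {q} {r} k = tabulate (finToFun {q} {r} k)

index : ∀ {q r} → Vec (Fin q) r → Fin (q ^ r)
index cs = funToFin (lookup cs)

coefficients-index : ∀ {q r} (cs : Vec (Fin q) r) → coefficients (index cs) ≡ cs
coefficients-index cs = trans (tabulate-cong (finToFun-funToFin (lookup cs))) (tabulate∘lookup cs)

1<q : ∀ {q} → FiniteField q → 1 < q
1<q {zero}        F with FiniteField.0# F
... | ()
1<q {suc zero}    F with FiniteField.0# F | FiniteField.1# F | FiniteField.0≢1 F
... | Fin.zero | Fin.zero | 0≢1 = contradiction refl 0≢1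
1<q {suc (suc q)} F = s≤s (s≤s z≤n)

q^r-nonZero : ∀ {q} → FiniteField q → ∀ r → NonZero (q ^ r)
q^r-nonZero {q} F r = m^n≢0 q r {{>-nonZero (<-trans z<s (1<q F))}}

module _ {q : ℕ} (F : FiniteField q) where
  open FiniteField F using (0#; -_; isCommutativeRing) renaming (_+_ to _+ᶠ_)
  open IsCommutativeRing isCommutativeRing using (-‿inverseˡ)

  vanishingOn : ∀ {n} → Subset n → List (Vecₙ F n)
  vanishingOn []            = [] ∷ []
  vanishingOn (inside  ∷ s) = map (0# ∷_) (vanishingOn s)
  vanishingOn (outside ∷ s) = cartesianProductWith _∷_ (allFin q) (vanishingOn s)

  length-vanishingOn : ∀ {n} (s : Subset n) → length (vanishingOn s) ≡ q ^ (n ∸ ∣ s ∣)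
  length-vanishingOn s = trans (length-vanishingOn-∁ s) (cong (q ^_) (∣∁p∣≡n∸∣p∣ s))
    where
      length-vanishingOn-∁ : ∀ {n} (s : Subset n) → length (vanishingOn s) ≡ q ^ ∣ ∁ s ∣
      length-vanishingOn-∁ []            = refl
      length-vanishingOn-∁ (inside  ∷ s) = trans (length-map (0# ∷_) (vanishingOn s)) (length-vanishingOn-∁ s)
      length-vanishingOn-∁ (outside ∷ s) =
        trans (length-cartesianProductWith _∷_ (allFin q) (vanishingOn s))
              (cong₂ _*_ (length-tabulate {n = q} id) (length-vanishingOn-∁ s))

  ∈-vanishingOn : ∀ {n} (s : Subset n) {x : Vecₙ F n} → (∀ {i} → i ∈ₛ s → lookup x i ≡ 0#) → x ∈ vanishingOn s
  ∈-vanishingOn []            {[]}    _  = here refl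
  ∈-vanishingOn (inside  ∷ s) {a ∷ x} x₀ rewrite x₀ here = ∈-map⁺ (0# ∷_) (∈-vanishingOn s (x₀ ∘ there))
  ∈-vanishingOn (outside ∷ s) {a ∷ x} x₀ =
    ∈-cartesianProductWith⁺ _∷_ (∈-allFin a) (∈-vanishingOn s (x₀ ∘ there))

  module _ {n k : ℕ} (B : Fin k → Subset n) (w : Fin k → Vecₙ F n) where

    private
      correction : (i : Fin n) → Dec (∃ λ a → i ∈ₛ B a) → Fin q
      correction i (yes (a , _)) = - lookup (w a) i
      correction i (no _)        = 0#

    cancelOn : Vecₙ F n
    cancelOn = tabulate λ i → correction i (any? λ a → i ∈? B a)

    cancelOn-⊕-∈-vanishingOn : (∀ {a b i} → i ∈ₛ B a → i ∈ₛ B b → a ≡ b) →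
                               ∀ a → _⊕_ F cancelOn (w a) ∈ vanishingOn (B a)
    cancelOn-⊕-∈-vanishingOn disjoint a = ∈-vanishingOn (B a) λ {i} i∈Ba → begin
      lookup (_⊕_ F cancelOn (w a)) i                          ≡⟨ lookup-zipWith _+ᶠ_ i cancelOn (w a) ⟩
      lookup cancelOn i +ᶠ lookup (w a) i                      ≡⟨ cong (_+ᶠ lookup (w a) i) (lookup∘tabulate _ i) ⟩
      correction i (any? λ b → i ∈? B b) +ᶠ lookup (w a) i     ≡⟨ cancels i∈Ba (any? λ b → i ∈? B b) ⟩
      0#                                                       ∎
      where
        open ≡-Reasoning
        cancels : ∀ {i} → i ∈ₛ B a → (d : Dec (∃ λ b → i ∈ₛ B b)) → correction i d +ᶠ lookup (w a) i ≡ 0#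
        cancels i∈Ba (yes (b , i∈Bb)) rewrite disjoint i∈Bb i∈Ba = -‿inverseˡ _
        cancels i∈Ba (no ∄b)          = contradiction (a , i∈Ba) ∄b

module _ {q : ℕ} (F : FiniteField q) (n r : ℕ) where

  private
    Q : ℕ
    Q = q ^ r

    instance
      Q≢0 : NonZero Q
      Q≢0 = q^r-nonZero F r

    m : ℕ
    m = n / Q

  block : Fin Q → Subset n
  block k = interval (toℕ k * m) m

  ∣block∣ : ∀ k → ∣ block k ∣ ≡ m
  ∣block∣ k = ∣interval∣ (toℕ k * m) m (begin
    toℕ k * m + m    ≡⟨ +-comm (toℕ k * m) m ⟩
    suc (toℕ k) * m  ≤⟨ *-monoˡ-≤ m (toℕ<n k) ⟩
    Q * m            ≡⟨ *-comm Q m ⟩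
    m * Q            ≤⟨ m/n*n≤m n Q ⟩
    n                ∎)
    where open ≤-Reasoning

  block-disjoint : ∀ {k l i} → i ∈ₛ block k → i ∈ₛ block l → k ≡ l
  block-disjoint {k} {l} i∈k i∈l with ∈-interval⁻ (toℕ k * m) m i∈k | ∈-interval⁻ (toℕ l * m) m i∈l
  ... | k*m≤i , i<k*m+m | l*m≤i , i<l*m+m =
    toℕ-injective (≤-antisym (a*m≤j<b*m+m⇒a≤b m k*m≤i i<l*m+m) (a*m≤j<b*m+m⇒a≤b m l*m≤i i<k*m+m))

  blockKakeya : List (Vecₙ F n)
  blockKakeya = deduplicate (≡-dec Fin._≟_) (concatMap (vanishingOn F ∘ block) (allFin Q))

  blockKakeya-isKakeya : IsKakeya F n r blockKakeya
  blockKakeya-isKakeya vs _ = v , λ cs →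
    ∈-deduplicate⁺ (≡-dec Fin._≟_) (∈-concatMap⁺ (vanishingOn F ∘ block) (lose (∈-allFin (index cs)) (lands cs)))
    where
      w : Fin Q → Vecₙ F n
      w k = lincomb F (coefficients k) vs

      v : Vecₙ F n
      v = cancelOn F block w

      lands : ∀ cs → _⊕_ F v (lincomb F cs vs) ∈ vanishingOn F (block (index cs))
      lands cs = subst (λ c → _⊕_ F v (lincomb F c vs) ∈ vanishingOn F (block (index cs)))
                       (coefficients-index cs)
                       (cancelOn-⊕-∈-vanishingOn F block w block-disjoint (index cs))

  length-blockKakeya : length blockKakeya ≤ Q * q ^ (n ∸ m)
  length-blockKakeya = begin
    length blockKakeya                                    ≤⟨ length-deduplicate _ (concatMap (vanishingOn F ∘ block) (allFin Q)) ⟩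
    length (concatMap (vanishingOn F ∘ block) (allFin Q)) ≤⟨ length-concatMap-≤ (vanishingOn F ∘ block) length-block (allFin Q) ⟩
    length (allFin Q) * q ^ (n ∸ m)                       ≡⟨ cong (_* q ^ (n ∸ m)) (length-tabulate {n = Q} id) ⟩
    Q * q ^ (n ∸ m)                                       ∎
    where
      open ≤-Reasoning
      length-block : ∀ k → length (vanishingOn F (block k)) ≤ q ^ (n ∸ m)
      length-block k = ≤-reflexive (trans (length-vanishingOn F (block k)) (cong (λ b → q ^ (n ∸ b)) (∣block∣ k)))

corollary3 : ∀ (q : ℕ) (F : FiniteField q) (n r : ℕ) → 1 ≤ r → r ≤ n →
    ∃ λ (K : List (Vecₙ F n)) →
    Unique K × IsKakeya F n r K ×
    length K ^ (q ^ r) < q ^ (n * (q ^ r ∸ 1) + (r + 1) * q ^ r)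
corollary3 q F n r _ _ =
  blockKakeya F n r , deduplicate-! (≡-dec Fin._≟_) _ , blockKakeya-isKakeya F n r , size
  where
    open ≤-Reasoning
    Q : ℕ
    Q = q ^ r
    instance
      Q≢0 : NonZero Q
      Q≢0 = q^r-nonZero F r
    size : length (blockKakeya F n r) ^ Q < q ^ (n * (Q ∸ 1) + (r + 1) * Q)
    size = begin-strict
      length (blockKakeya F n r) ^ Q  ≤⟨ ^-monoˡ-≤ Q (length-blockKakeya F n r) ⟩
      (Q * q ^ (n ∸ n / Q)) ^ Q       ≡⟨ cong (_^ Q) (^-distribˡ-+-* q r (n ∸ n / Q)) ⟨
      (q ^ (r + (n ∸ n / Q))) ^ Q     ≡⟨ ^-*-assoc q (r + (n ∸ n / Q)) Q ⟩
      q ^ ((r + (n ∸ n / Q)) * Q)     <⟨ ^-monoʳ-< q (1<q F) (exponent-bound n r Q) ⟩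
      q ^ (n * (Q ∸ 1) + (r + 1) * Q) ∎
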